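{- Let $D$ be a loose $k$-partite tournament ($k\ge 3$) and let $X_1$ be a partite set of $D$ that is not $\{1,2\}$-competing. If a vertex $x\in X_1$ has out-neighbors in two distinct partite sets of $D$, then $x$ is adjacent in $C_{1,2}(D)$ to every non-sink vertex of $D$ other than $x$.
   Context: All graphs and digraphs are finite and simple. For a digraph $D$ and a vertex $v$, $N^+(v)$ is the out-neighborhood of $v$; a sink is a vertex of outdegree $0$. $d_D(x,y)$ is the length of a shortest directed path from $x$ to $y$ in $D$. The $(1,2)$-step competition graph $C_{1,2}(D)$ is the graph on $V(D)$ in which distinct $u,v$ are adjacent iff there is a vertex $w\notin\{u,v\}$ with either $d_{D-v}(u,w)\le 1$ and $d_{D-u}(v,w)\le 2$, or $d_{D-u}(v,w)\le 1$ and $d_{D-v}(u,w)\le 2$. A $k$-partite tournament is an orientation of a complete $k$-partite graph (with $k$ nonempty partite sets); a multipartite tournament is a $k$-partite tournament with $k\ge3$. A set of vertices is $\{1,2\}$-competing if it is a clique in $C_{1,2}(D)$, and anti-$\{1,2\}$-competing if it is a stable set in $C_{1,2}(D)$. A multipartite tournament is loose if some partite set is not $\{1,2\}$-competing. -}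

module Defs where

open import Data.Nat using (ℕ; _≥_)
open import Data.Fin using (Fin)
open import Data.Product using (Σ; ∃; ∃-syntax; _×_; _,_)
open import Data.Sum using (_⊎_)
open import Relation.Nullary using (¬_)
open import Relation.Binary.PropositionalEquality using (_≡_; _≢_)

-- A digraph on vertex set Fin n, given by its arc relation.
-- (Simplicity / looplessness is enforced by the multipartite-tournament
-- axioms below.)
Digraph : ℕ → Set₁
Digraph n = Fin n → Fin n → Set

record IsKPartiteTournament {n : ℕ} (k : ℕ) (D : Digraph n) (p : Fin n → Fin k) : Set where
  field
    nonempty   : ∀ (i : Fin k) → ∃[ v ] p v ≡ i
    noArcInside : ∀ u v → p u ≡ p v → ¬ D u v
    oneArc     : ∀ u v → p u ≢ p v → D u v ⊎ D v u
    notBoth    : ∀ u v → D u v → ¬ D v u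

-- d_{D - a}(u , w) ≤ 1, for u , w ≠ a
Dist≤1 : ∀ {n} → Digraph n → (a u w : Fin n) → Set
Dist≤1 D a u w = u ≡ w ⊎ D u w

-- d_{D - a}(u , w) ≤ 2, for u , w ≠ a (intermediate vertex must avoid a)
Dist≤2 : ∀ {n} → Digraph n → (a u w : Fin n) → Set
Dist≤2 D a u w = Dist≤1 D a u w ⊎ (∃[ z ] (z ≢ a × D u z × D z w))

C12Adj : ∀ {n} → Digraph n → Fin n → Fin n → Set
C12Adj D u v =
  u ≢ v × (∃[ w ] (w ≢ u × w ≢ v ×
     ((Dist≤1 D v u w × Dist≤2 D u v w) ⊎ (Dist≤1 D u v w × Dist≤2 D v u w))))

Competing12 : ∀ {n k} → Digraph n → (Fin n → Fin k) → Fin k → Set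
Competing12 D p i = ∀ u v → p u ≡ i → p v ≡ i → u ≢ v → C12Adj D u v

Loose : ∀ {n k} → Digraph n → (Fin n → Fin k) → Set
Loose {k = k} D p = ∃[ i ] ¬ Competing12 D p i

Sink : ∀ {n} → Digraph n → Fin n → Set
Sink D v = ∀ w → ¬ D v w

NonSink : ∀ {n} → Digraph n → Fin n → Set
NonSink D v = ∃[ w ] D v w

{-# OPTIONS --safe #-}
module Submission where

open import Defs
open import Data.Nat using (ℕ; _≥_)
open import Data.Fin using (Fin)
open import Data.Fin.Properties using (any?; _≟_)
open import Data.Product using (∃-syntax; _×_; _,_)
open import Data.Sum using (_⊎_; inj₁; inj₂)
open import Data.Empty using (⊥-elim)
open import Relation.Binary.Definitions using (Irreflexive; Decidable)
open import Relation.Nullary using (¬_; Dec; yes; no)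
open import Relation.Nullary.Decidable using (decidable-stable)
open import Relation.Nullary.Decidable.Core using (_×-dec_; _⊎-dec_; ¬?)
open import Relation.Binary.PropositionalEquality using (_≡_; _≢_; refl; sym; trans)

-- Suppose x and v are not adjacent in C_{1,2}(D). An out-neighbour w ≠ v of x and an
-- out-neighbour t ≠ x of v cannot be joined by an arc (it would give x → w → t ← v or
-- v → t → w ← x), so they lie in one partite set. As x has out-neighbours in two partite sets,
-- this forces v ∉ X₁, r → v for every r ∈ X₁ ∖ {x}, and x → w → v for some w. Then two
-- vertices of X₁ ∖ {x} compete through v, and x competes with every r ∈ X₁ ∖ {x} through
-- x → w → v ← r, so X₁ would be {1,2}-competing.

module LooplessDigraph {n : ℕ} (D : Digraph n) (loopless : Irreflexive _≡_ D) where

  arc⇒≢ : ∀ {u v} → D u v → u ≢ v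
  arc⇒≢ uv u≡v = loopless u≡v uv

  C12Adj-sym : ∀ {u v} → C12Adj D u v → C12Adj D v u
  C12Adj-sym (u≢v , w , w≢u , w≢v , inj₁ dists) = (λ v≡u → u≢v (sym v≡u)) , w , w≢v , w≢u , inj₂ dists
  C12Adj-sym (u≢v , w , w≢u , w≢v , inj₂ dists) = (λ v≡u → u≢v (sym v≡u)) , w , w≢v , w≢u , inj₁ dists

  commonOut⇒C12Adj : ∀ {u v w} → u ≢ v → D u w → D v w → C12Adj D u v
  commonOut⇒C12Adj u≢v uw vw =
    u≢v , _ , (λ w≡u → arc⇒≢ uw (sym w≡u)) , (λ w≡v → arc⇒≢ vw (sym w≡v)) ,
    inj₁ (inj₂ uw , inj₁ (inj₂ vw))

  path₂⇒C12Adj : ∀ {u v a w} → u ≢ v → D u a → D a w → a ≢ v → D v w → w ≢ u → C12Adj D u v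
  path₂⇒C12Adj u≢v ua aw a≢v vw w≢u =
    u≢v , _ , w≢u , (λ w≡v → arc⇒≢ vw (sym w≡v)) , inj₂ (inj₂ vw , inj₂ (_ , a≢v , ua , aw))

module KPartiteTournament {n k : ℕ} {D : Digraph n} {p : Fin n → Fin k}
                          (T : IsKPartiteTournament k D p) where
  open IsKPartiteTournament T

  loopless : Irreflexive _≡_ D
  loopless {u} refl = noArcInside u u refl

  open LooplessDigraph D loopless public

  arc⇒differentParts : ∀ {u v} → D u v → p u ≢ p v
  arc⇒differentParts {u} {v} uv pu≡pv = noArcInside u v pu≡pv uv

  differentParts⇒≢ : ∀ {u v} → p u ≢ p v → u ≢ v
  differentParts⇒≢ pu≢pv refl = pu≢pv refl

  reverse-arc : ∀ {u v} → p u ≢ p v → ¬ D u v → D v u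
  reverse-arc {u} {v} pu≢pv ¬uv with oneArc u v pu≢pv
  ... | inj₁ uv = ⊥-elim (¬uv uv)
  ... | inj₂ vu = vu

  arc? : Decidable D
  arc? u v with p u ≟ p v
  ... | yes pu≡pv = no (noArcInside u v pu≡pv)
  ... | no pu≢pv with oneArc u v pu≢pv
  ...   | inj₁ uv = yes uv
  ...   | inj₂ vu = no (notBoth v u vu)

  Dist≤1? : ∀ a u w → Dec (Dist≤1 D a u w)
  Dist≤1? _ u w = u ≟ w ⊎-dec arc? u w

  Dist≤2? : ∀ a u w → Dec (Dist≤2 D a u w)
  Dist≤2? a u w = Dist≤1? a u w ⊎-dec any? (λ z → ¬? (z ≟ a) ×-dec arc? u z ×-dec arc? z w)

  C12Adj? : Decidable (C12Adj D)
  C12Adj? u v = ¬? (u ≟ v) ×-dec any? λ w → ¬? (w ≟ u) ×-dec ¬? (w ≟ v) ×-dec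
    (Dist≤1? v u w ×-dec Dist≤2? u v w ⊎-dec Dist≤1? u v w ×-dec Dist≤2? v u w)

  module NonAdjacent {x v : Fin n} (x≢v : x ≢ v) (¬adj : ¬ C12Adj D x v) where

    v≢x : v ≢ x
    v≢x v≡x = x≢v (sym v≡x)

    outNeighbours-samePart : ∀ {w t} → D x w → D v t → w ≢ v → t ≢ x → p w ≡ p t
    outNeighbours-samePart {w} {t} xw vt w≢v t≢x with p w ≟ p t
    ... | yes pw≡pt = pw≡pt
    ... | no pw≢pt with oneArc w t pw≢pt
    ...   | inj₁ wt = ⊥-elim (¬adj (path₂⇒C12Adj x≢v xw wt w≢v vt t≢x))
    ...   | inj₂ tw = ⊥-elim (¬adj (C12Adj-sym (path₂⇒C12Adj v≢x vt tw t≢x xw w≢v)))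

    ¬v→outNeighbour-of-x : ∀ {w} → D x w → ¬ D v w
    ¬v→outNeighbour-of-x xw vw = ¬adj (commonOut⇒C12Adj x≢v xw vw)

    outNeighbour-of-x-into-v : ∀ {y z} → D x y → D x z → p y ≢ p z → ∃[ w ] D x w × D w v
    outNeighbour-of-x-into-v {y} {z} xy xz py≢pz with p v ≟ p y
    ... | no pv≢py = y , xy , reverse-arc pv≢py (¬v→outNeighbour-of-x xy)
    ... | yes pv≡py = z , xz , reverse-arc (λ pv≡pz → py≢pz (trans (sym pv≡py) pv≡pz))
                                           (¬v→outNeighbour-of-x xz)

    v∉part-of-x : ∀ {y z} → D x y → D x z → p y ≢ p z → NonSink D v → p v ≢ p x
    v∉part-of-x xy xz py≢pz (t , vt) pv≡px =
      py≢pz (trans (outNeighbours-samePart xy vt (outside xy) t≢x)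
                   (sym (outNeighbours-samePart xz vt (outside xz) t≢x)))
      where
        t≢x : t ≢ x
        t≢x = differentParts⇒≢ (λ pt≡px → arc⇒differentParts vt (trans pv≡px (sym pt≡px)))

        outside : ∀ {w} → D x w → w ≢ v
        outside xw = differentParts⇒≢ (λ pw≡pv → arc⇒differentParts xw (sym (trans pw≡pv pv≡px)))

    module _ (v∉X : p v ≢ p x) {w : Fin n} (xw : D x w) (wv : D w v) where

      part-of-x-into-v : ∀ r → p r ≡ p x → r ≢ x → D r v
      part-of-x-into-v r pr≡px r≢x = reverse-arc (λ pv≡pr → v∉X (trans pv≡pr pr≡px)) ¬vr
        where
          ¬vr : ¬ D v r
          ¬vr vr = arc⇒differentParts xw
                     (sym (trans (outNeighbours-samePart xw vr (arc⇒≢ wv) r≢x) pr≡px))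

      x-C12Adj-part-of-x : ∀ r → p r ≡ p x → r ≢ x → C12Adj D x r
      x-C12Adj-part-of-x r pr≡px r≢x =
        path₂⇒C12Adj (λ x≡r → r≢x (sym x≡r)) xw wv w≢r (part-of-x-into-v r pr≡px r≢x) v≢x
        where
          w≢r : w ≢ r
          w≢r = differentParts⇒≢ (λ pw≡pr → arc⇒differentParts xw (sym (trans pw≡pr pr≡px)))

      competing-through-v : Competing12 D p (p x)
      competing-through-v u u′ pu pu′ u≢u′ with u ≟ x | u′ ≟ x
      ... | yes refl | yes refl = ⊥-elim (u≢u′ refl)
      ... | yes refl | no u′≢x  = x-C12Adj-part-of-x u′ pu′ u′≢x
      ... | no u≢x   | yes refl = C12Adj-sym (x-C12Adj-part-of-x u pu u≢x)
      ... | no u≢x   | no u′≢x  =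
        commonOut⇒C12Adj u≢u′ (part-of-x-into-v u pu u≢x) (part-of-x-into-v u′ pu′ u′≢x)

    part-of-x-competing : ∀ {y z} → D x y → D x z → p y ≢ p z → NonSink D v → Competing12 D p (p x)
    part-of-x-competing xy xz py≢pz v-nonsink with outNeighbour-of-x-into-v xy xz py≢pz
    ... | w , xw , wv = competing-through-v (v∉part-of-x xy xz py≢pz v-nonsink) xw wv

proposition3p2 : ∀ {n k : ℕ} (D : Digraph n) (p : Fin n → Fin k)
    → k ≥ 3
    → IsKPartiteTournament k D p
    → Loose D p
    → (X₁ : Fin k) → ¬ Competing12 D p X₁
    → (x : Fin n) → p x ≡ X₁
    → (∃[ y ] ∃[ z ] (D x y × D x z × p y ≢ p z))
    → ∀ (v : Fin n) → v ≢ x → NonSink D v → C12Adj D x v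
proposition3p2 D p _ T _ _ ¬competing x refl (y , z , xy , xz , py≢pz) v v≢x v-nonsink =
  decidable-stable (C12Adj? x v) λ ¬adj →
    ¬competing (NonAdjacent.part-of-x-competing (λ x≡v → v≢x (sym x≡v)) ¬adj xy xz py≢pz v-nonsink)
  where open KPartiteTournament T
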